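{- Let $F=(F_n)$ be a linear-like semiring family of graphs and $G$ a finite graph. Then \[ \eta_{F,f}(G)=\inf\left\{ \frac{\mathrm{rk}\big(\bigcup_{v\in V(G)}\phi(v)\big)}{r} \;:\; r\in\mathbb{N}_+,\ \phi \text{ is a rank- }r\text{ -representation of } G\right\}, \] where the rank of the union is computed in the graph $F_m$ that is the codomain of $\phi$.
   Context: Graphs are undirected simple graphs, possibly infinite; $\omega$ is the clique number. The join $G+H$ is the disjoint union with all edges between the two parts added; the disjunctive product $G\ast H$ has vertex set $V(G)\times V(H)$ with $(v,w)\sim(v',w')$ iff $v\sim v'$ or $w\sim w'$. A semiring family is a sequence $(F_n)_{n\in\mathbb{N}}$ with $F_0=\emptyset$, $F_1\ne\emptyset$, and homomorphisms $F_n+F_m\to F_{n+m}$, $F_n\ast F_m\to F_{nm}$. For $S\subseteq V(X)$, $S^\perp$ is the set of vertices adjacent to all vertices of $S$; $S$ is a flat if $S^{\perp\perp}=S$; $\mathrm{rk}(S)=\omega(S^{\perp\perp})$. $(F_n)$ is linear-like if for every $n$ and every flat $S\subseteq V(F_n)$, the induced subgraph on $S$ is homomorphically equivalent to $F_{\mathrm{rk}(S)}$. The power graph $2^X$ has as vertices all subsets of $V(X)$, with $S\sim T$ iff $S\cap T=\emptyset$ and $s\sim t$ for all $s\in S,t\in T$; $X/d$ is its induced subgraph on the $d$-cliques of $X$. A rank-$r$-representation of $G$ is a graph homomorphism $\phi:G\to 2^{F_m}$ for some $m\in\mathbb{N}$ such that $\mathrm{rk}(\phi(v))\ge r$ in $F_m$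 for every $v\in V(G)$. The fractional $F$-number is $\eta_{F,f}(G)=\inf\{n/d: n\in\mathbb{N},d\in\mathbb{N}_+, G\to F_n/d\}$. -}

module Defs where

open import Level using (Level; _⊔_; 0ℓ; Lift; lift; lower) renaming (suc to lsuc)
open import Data.Nat using (ℕ; zero; suc; _+_; _*_)
open import Data.Integer using (+_)
open import Data.Rational using (ℚ; _/_; _≤_)
open import Data.Fin using (Fin)
open import Data.Product using (Σ; ∃; _×_; _,_; proj₁; proj₂)
open import Data.Sum using (_⊎_; inj₁; inj₂)
open import Data.Unit.Polymorphic using (⊤)
open import Data.Empty.Polymorphic using (⊥)
open import Relation.Nullary using (¬_)
open import Relation.Binary.PropositionalEquality using (_≡_; _≢_)
open import Function.Bundles using (_↔_; _⇔_)

-- Loops are NOT excluded in the record (the power graph 2^X has a loop at ∅);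
-- simplicity (looplessness) is imposed separately via `Loopless`.
record Graph (ℓ : Level) : Set (lsuc ℓ) where
  field
    V   : Set ℓ
    adj : V → V → Set ℓ
    sym : ∀ {u v} → adj u v → adj v u
open Graph public

Loopless : ∀ {ℓ} → Graph ℓ → Set ℓ
Loopless X = ∀ v → ¬ adj X v v

Finite : ∀ {ℓ} → Graph ℓ → Set ℓ
Finite X = Σ ℕ λ k → V X ↔ Fin k

Hom : ∀ {a b} → Graph a → Graph b → Set (a ⊔ b)
Hom G H = Σ (V G → V H) λ f → ∀ {u v} → adj G u v → adj H (f u) (f v)

HomEquiv : ∀ {a b} → Graph a → Graph b → Set (a ⊔ b)
HomEquiv G H = Hom G H × Hom H G

Join : ∀ {ℓ} → Graph ℓ → Graph ℓ → Graph ℓ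
Join G H = record { V = V G ⊎ V H ; adj = A ; sym = λ {u} {v} → s {u} {v} }
  where
  A : V G ⊎ V H → V G ⊎ V H → Set _
  A (inj₁ x) (inj₁ y) = adj G x y
  A (inj₂ x) (inj₂ y) = adj H x y
  A (inj₁ _) (inj₂ _) = ⊤
  A (inj₂ _) (inj₁ _) = ⊤
  s : ∀ {u v} → A u v → A v u
  s {inj₁ _} {inj₁ _} p = sym G p
  s {inj₂ _} {inj₂ _} p = sym H p
  s {inj₁ _} {inj₂ _} p = _
  s {inj₂ _} {inj₁ _} p = _

Disj : ∀ {ℓ} → Graph ℓ → Graph ℓ → Graph ℓ
Disj G H = record
  { V = V G × V H
  ; adj = λ p q → adj G (proj₁ p) (proj₁ q) ⊎ adj H (proj₂ p) (proj₂ q)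
  ; sym = λ { (inj₁ e) → inj₁ (sym G e) ; (inj₂ e) → inj₂ (sym H e) } }

record IsSemiringFamily {ℓ} (F : ℕ → Graph ℓ) : Set ℓ where
  field
    empty₀   : ¬ V (F 0)
    nonempty₁ : V (F 1)
    joinHom  : ∀ n m → Hom (Join (F n) (F m)) (F (n + m))
    prodHom  : ∀ n m → Hom (Disj (F n) (F m)) (F (n * m))

Induced : ∀ {a b} (X : Graph a) → (V X → Set b) → Graph (a ⊔ b)
Induced {a} {b} X P = record
  { V = Σ (V X) P
  ; adj = λ p q → Lift b (adj X (proj₁ p) (proj₁ q))
  ; sym = λ e → lift (sym X (lower e)) }

Subset : ∀ {ℓ} → Graph ℓ → Set (lsuc ℓ)
Subset {ℓ} X = V X → Set ℓ

perp : ∀ {ℓ} (X : Graph ℓ) → Subset X → Subset X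
perp X S x = ∀ y → S y → adj X x y

IsFlat : ∀ {ℓ} (X : Graph ℓ) → Subset X → Set ℓ
IsFlat X S = ∀ x → (perp X (perp X S) x → S x) × (S x → perp X (perp X S) x)

HasClique : ∀ {ℓ} → Graph ℓ → ℕ → Set ℓ
HasClique X k = Σ (Fin k → V X) λ f → ∀ i j → i ≢ j → adj X (f i) (f j)

CliqueNumber : ∀ {ℓ} → Graph ℓ → ℕ → Set ℓ
CliqueNumber X k = HasClique X k × ¬ HasClique X (suc k)

Rank : ∀ {ℓ} (X : Graph ℓ) → Subset X → ℕ → Set ℓ
Rank X S k = CliqueNumber (Induced X (perp X (perp X S))) k

-- rk(S) ≥ r  (S^⊥⊥ contains an r-clique; meaningful also for infinite rank)
RankAtLeast : ∀ {ℓ} (X : Graph ℓ) → Subset X → ℕ → Set ℓ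
RankAtLeast X S r = HasClique (Induced X (perp X (perp X S))) r

IsLinearLike : ∀ {ℓ} (F : ℕ → Graph ℓ) → Set (lsuc ℓ)
IsLinearLike F = ∀ n (S : Subset (F n)) → IsFlat (F n) S →
  Σ ℕ λ k → Rank (F n) S k × HomEquiv (Induced (F n) S) (F k)

PowerGraph : ∀ {ℓ} → Graph ℓ → Graph (lsuc ℓ)
PowerGraph {ℓ} X = record
  { V = Subset X
  ; adj = λ S T → (∀ x → S x → T x → ⊥) × (∀ s t → S s → T t → adj X s t)
  ; sym = λ { (d , a) → (λ x t s → d x s t) , (λ t s Tt Ss → sym X (a s t Ss Tt)) } }

IsCliqueSet : ∀ {ℓ} (X : Graph ℓ) → ℕ → Subset X → Set ℓ
IsCliqueSet X d S = Σ (Fin d → V X) λ f →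
  (∀ i j → i ≢ j → adj X (f i) (f j)) ×
  (∀ x → (S x → Σ (Fin d) λ i → f i ≡ x) × (Σ (Fin d) (λ i → f i ≡ x) → S x))

_/ᵍ_ : ∀ {ℓ} → Graph ℓ → ℕ → Graph (lsuc ℓ)
X /ᵍ d = Induced (PowerGraph X) (IsCliqueSet X d)

IsRankRep : ∀ {ℓ} (F : ℕ → Graph ℓ) (G : Graph 0ℓ) (r m : ℕ) →
  Hom G (PowerGraph (F m)) → Set ℓ
IsRankRep F G r m φ = ∀ v → RankAtLeast (F m) (proj₁ φ v) r

Union : ∀ {ℓ} {X : Graph ℓ} (G : Graph 0ℓ) → (V G → Subset X) → Subset X
Union G φ x = Σ (V G) λ v → φ v x

-- the set {n/d : n ∈ ℕ, d ∈ ℕ₊, G → F_n/d}  (d = suc d')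
EtaSet : ∀ {ℓ} (F : ℕ → Graph ℓ) (G : Graph 0ℓ) → ℚ → Set (lsuc ℓ)
EtaSet F G q = Σ ℕ λ n → Σ ℕ λ d' →
  Hom G (F n /ᵍ suc d') × (q ≡ (+ n) / suc d')

-- the set {rk(⋃ φ(v)) / r : r ∈ ℕ₊, φ rank-r-representation}  (r = suc r');
-- only finite ranks give rational values (infinite values do not affect the infimum)
RepSet : ∀ {ℓ} (F : ℕ → Graph ℓ) (G : Graph 0ℓ) → ℚ → Set (lsuc ℓ)
RepSet F G q = Σ ℕ λ r' → Σ ℕ λ m → Σ (Hom G (PowerGraph (F m))) λ φ →
  IsRankRep F G (suc r') m φ ×
  (Σ ℕ λ k → Rank (F m) (Union {X = F m} G (proj₁ φ)) k × (q ≡ (+ k) / suc r'))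

IsLowerBound : ∀ {a} → (ℚ → Set a) → ℚ → Set a
IsLowerBound A q = ∀ p → A p → q ≤ p

-- inf A = inf B (in ℝ ∪ {+∞}) for sets of rationals: same rational lower bounds
SameInf : ∀ {a b} → (ℚ → Set a) → (ℚ → Set b) → Set (a ⊔ b)
SameInf A B = ∀ q → IsLowerBound A q ⇔ IsLowerBound B q

-- For a hom G → F_n/d, the d-cliques φ(v) form a rank-d representation whose union has
-- rank k ≤ ω(F_n) = n, so n/d is dominated by k/d.  Conversely, for a rank-r representation φ
-- in F_m with union of rank k, the closure W of the union is a flat, so F_m[W] ↔ F_k by
-- linear-likeness; an r-clique of each φ(v)^⊥⊥ ⊆ W is sent into F_k, and closures of
-- completely joined sets are completely joined, giving a hom G → F_k/r.  Hence the set of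
-- representation values lies inside the set defining η_{F,f}(G) and is coinitial in it.
module Submission where

open import Defs
open import Level using (Level; 0ℓ; lift; lower)
open import Data.Nat using (ℕ; zero; suc; _+_; _∸_; _≤_; _≤?_)
open import Data.Nat.Properties
  using (≤-antisym; ≰⇒>; +-cancelˡ-≤; +-identityʳ; n≤0⇒n≡0; m∸n≡0⇒m≤n; m+[n∸m]≡n)
open import Data.Fin using (Fin; splitAt; join; inject≤) renaming (zero to fzero)
open import Data.Fin.Properties using (join-splitAt; inject≤-injective)
open import Data.Integer using (+_)
import Data.Integer as ℤ
import Data.Integer.Properties as ℤ
open import Data.Rational using (ℚ; _/_) renaming (_≤_ to _≤ℚ_)
import Data.Rational.Properties as ℚ
import Data.Rational.Unnormalised.Base as ℚᵘ
import Data.Rational.Unnormalised.Properties as ℚᵘ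
open import Data.Product using (∃; _×_; _,_; proj₁; proj₂)
open import Data.Sum using (_⊎_; inj₁; inj₂)
open import Data.Unit.Polymorphic using (⊤; tt)
open import Data.Empty using (⊥-elim)
open import Relation.Nullary using (¬_; yes; no)
open import Relation.Binary.PropositionalEquality using (_≡_; _≢_; refl; cong; trans; subst; subst₂)
  renaming (sym to ≡-sym)
open import Function.Bundles using (mk⇔)

/-monoˡ-≤ : ∀ {k n} d → k ≤ n → (+ k) / suc d ≤ℚ (+ n) / suc d
/-monoˡ-≤ {k} {n} d k≤n = ℚ.toℚᵘ-cancel-≤
  (ℚᵘ.≤-respˡ-≃ (ℚᵘ.≃-sym (ℚ.toℚᵘ-fromℚᵘ (ℚᵘ.mkℚᵘ (+ k) d)))
  (ℚᵘ.≤-respʳ-≃ (ℚᵘ.≃-sym (ℚ.toℚᵘ-fromℚᵘ (ℚᵘ.mkℚᵘ (+ n) d)))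
  (ℚᵘ.*≤* (ℤ.*-monoʳ-≤-nonNeg (+ suc d) (ℤ.+≤+ k≤n)))))

SameInf-coinitial : ∀ {a b} {A : ℚ → Set a} {B : ℚ → Set b} →
  (∀ p → B p → A p) → (∀ p → A p → ∃ λ p′ → B p′ × p′ ≤ℚ p) → SameInf A B
SameInf-coinitial B⊆A coinitial q = mk⇔
  (λ lbA p Bp → lbA p (B⊆A p Bp))
  (λ lbB p Ap → let (p′ , Bp′ , p′≤p) = coinitial p Ap in ℚ.≤-trans (lbB p′ Bp′) p′≤p)

Hom-HasClique : ∀ {a b} (X : Graph a) (Y : Graph b) {k} → Hom X Y → HasClique X k → HasClique Y k
Hom-HasClique _ _ (h , h-adj) (f , clique) = (λ i → h (f i)) , λ i j i≢j → h-adj (clique i j i≢j)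

HomEquiv-CliqueNumber : ∀ {a b} (X : Graph a) (Y : Graph b) {k} →
  HomEquiv X Y → CliqueNumber X k → CliqueNumber Y k
HomEquiv-CliqueNumber X Y (to , from) (hasK , noSucK) =
  Hom-HasClique X Y to hasK , λ c → noSucK (Hom-HasClique Y X from c)

module _ {a : Level} (X : Graph a) where

  HasClique-≤ : ∀ {k k′} → k ≤ k′ → HasClique X k′ → HasClique X k
  HasClique-≤ k≤k′ (f , clique) =
    (λ i → f (inject≤ i k≤k′)) ,
    λ i j i≢j → clique _ _ (λ e → i≢j (inject≤-injective k≤k′ k≤k′ i j e))

  HasClique⇒≤ : ∀ {k b} → HasClique X k → ¬ HasClique X (suc b) → k ≤ b
  HasClique⇒≤ {k} {b} hasK noSucB with k ≤? b
  ... | yes k≤b = k≤b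
  ... | no  k≰b = ⊥-elim (noSucB (HasClique-≤ (≰⇒> k≰b) hasK))

  CliqueNumber-unique : ∀ {m n} → CliqueNumber X m → CliqueNumber X n → m ≡ n
  CliqueNumber-unique (hasM , noSucM) (hasN , noSucN) =
    ≤-antisym (HasClique⇒≤ hasM noSucN) (HasClique⇒≤ hasN noSucM)

  Induced-⊆ : ∀ {b c} {P : V X → Set b} {Q : V X → Set c} →
    (∀ x → P x → Q x) → Hom (Induced X P) (Induced X Q)
  Induced-⊆ P⊆Q = (λ (x , Px) → x , P⊆Q x Px) , λ e → lift (lower e)

  Induced-proj : ∀ {b} {P : V X → Set b} → Hom (Induced X P) X
  Induced-proj = proj₁ , lower

  Induced-full : HomEquiv (Induced X (λ _ → ⊤ {a})) X
  Induced-full = Induced-proj , ((λ x → x , tt) , lift)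

module _ {ℓ} (X Y : Graph ℓ) where

  Join-HasClique : ∀ {m n} → HasClique X m → HasClique Y n → HasClique (Join X Y) (m + n)
  Join-HasClique {m} {n} (f , f-clique) (g , g-clique) =
    (λ i → [f,g] (splitAt m i)) ,
    λ i j i≢j → clique (splitAt m i) (splitAt m j) (λ e → i≢j (splitAt-injective e))
    where
    [f,g] : Fin m ⊎ Fin n → V (Join X Y)
    [f,g] (inj₁ i) = inj₁ (f i)
    [f,g] (inj₂ j) = inj₂ (g j)

    splitAt-injective : ∀ {i j} → splitAt m i ≡ splitAt m j → i ≡ j
    splitAt-injective {i} {j} e =
      trans (≡-sym (join-splitAt m n i)) (trans (cong (join m n) e) (join-splitAt m n j))

    clique : ∀ u w → u ≢ w → adj (Join X Y) ([f,g] u) ([f,g] w)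
    clique (inj₁ i) (inj₁ j) u≢w = f-clique i j (λ e → u≢w (cong inj₁ e))
    clique (inj₁ _) (inj₂ _) _   = tt
    clique (inj₂ _) (inj₁ _) _   = tt
    clique (inj₂ i) (inj₂ j) u≢w = g-clique i j (λ e → u≢w (cong inj₂ e))

module Closure {ℓ} (X : Graph ℓ) where

  _⊆_ : Subset X → Subset X → Set ℓ
  S ⊆ T = ∀ x → S x → T x

  perp² : Subset X → Subset X
  perp² S = perp X (perp X S)

  perp-antitone : ∀ {S T} → S ⊆ T → perp X T ⊆ perp X S
  perp-antitone S⊆T x x⊥T y Sy = x⊥T y (S⊆T y Sy)

  perp²-monotone : ∀ {S T} → S ⊆ T → perp² S ⊆ perp² T
  perp²-monotone S⊆T = perp-antitone (perp-antitone S⊆T)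

  ⊆-perp² : ∀ S → S ⊆ perp² S
  ⊆-perp² S x Sx y y⊥S = sym X (y⊥S x Sx)

  perp²-isFlat : ∀ S → IsFlat X (perp² S)
  perp²-isFlat S x = perp-antitone (⊆-perp² (perp X S)) x , ⊆-perp² (perp² S) x

  perp²-joined : ∀ {S T} → (∀ s t → S s → T t → adj X s t) →
    ∀ s t → perp² S s → perp² T t → adj X s t
  perp²-joined S-T s t s∈S⊥⊥ t∈T⊥⊥ =
    sym X (t∈T⊥⊥ s (λ y Ty → s∈S⊥⊥ y (λ z Sz → sym X (S-T z y Sz Ty))))

  Induced-flat : ∀ {S} → IsFlat X S → HomEquiv (Induced X (perp² S)) (Induced X S)
  Induced-flat flat = Induced-⊆ X (λ x → proj₁ (flat x)) , Induced-⊆ X (λ x → proj₂ (flat x))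

  Rank-perp² : ∀ {S k} → Rank X (perp² S) k → Rank X S k
  Rank-perp² {S} = HomEquiv-CliqueNumber (Induced X (perp² (perp² S))) (Induced X (perp² S))
    (Induced-flat (perp²-isFlat S))

  Rank⇒HasClique : ∀ {S k} → Rank X S k → HasClique X k
  Rank⇒HasClique {S} (hasK , _) = Hom-HasClique (Induced X (perp² S)) X (Induced-proj X) hasK

  IsCliqueSet⇒RankAtLeast : ∀ {S d} → IsCliqueSet X d S → RankAtLeast X S d
  IsCliqueSet⇒RankAtLeast {S} (f , clique , members) =
    Hom-HasClique (Induced X S) (Induced X (perp² S)) (Induced-⊆ X (⊆-perp² S))
      ((λ i → f i , proj₂ (members (f i)) (i , refl)) , λ i j i≢j → lift (clique i j i≢j))

  image : ∀ {d} → (Fin d → V X) → Subset X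
  image f x = ∃ λ i → f i ≡ x

  image-IsCliqueSet : ∀ {d} ((f , _) : HasClique X d) → IsCliqueSet X d (image f)
  image-IsCliqueSet (f , clique) = f , clique , λ x → (λ x∈f → x∈f) , (λ x∈f → x∈f)

  -- Looplessness is what makes completely joined images disjoint.
  image-adj : Loopless X → ∀ {d e} {f : Fin d → V X} {g : Fin e → V X} →
    (∀ i j → adj X (f i) (g j)) → adj (PowerGraph X) (image f) (image g)
  image-adj loopless f-g =
    (λ x (i , fi≡x) (j , gj≡x) → ⊥-elim (loopless x (subst₂ (adj X) fi≡x gj≡x (f-g i j)))) ,
    (λ s t (i , fi≡s) (j , gj≡t) → subst₂ (adj X) fi≡s gj≡t (f-g i j))

  /ᵍ⇒PowerGraph : ∀ {d} (G : Graph 0ℓ) → Hom G (X /ᵍ d) → Hom G (PowerGraph X)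
  /ᵍ⇒PowerGraph G (h , h-adj) = (λ v → proj₁ (h v)) , λ e → lower (h-adj e)

  Hom-/ᵍ : Loopless X → ∀ {d} (G : Graph 0ℓ) (cliques : V G → HasClique X d) →
    (∀ {v w} → adj G v w → ∀ i j → adj X (proj₁ (cliques v) i) (proj₁ (cliques w) j)) →
    Hom G (X /ᵍ d)
  Hom-/ᵍ loopless G cliques joined =
    (λ v → image (proj₁ (cliques v)) , image-IsCliqueSet (cliques v)) ,
    λ e → lift (image-adj loopless (joined e))

module LinearLike {ℓ} (F : ℕ → Graph ℓ) (semiring : IsSemiringFamily F)
                  (loopless : ∀ n → Loopless (F n)) (linear : IsLinearLike F) where
  open IsSemiringFamily semiring
  open Closure

  F-HasClique : ∀ n → HasClique (F n) n
  F-HasClique zero    = (λ ()) , λ ()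
  F-HasClique (suc n) = Hom-HasClique (Join (F 1) (F n)) (F (suc n)) (joinHom 1 n)
    (Join-HasClique (F 1) (F n) vertex (F-HasClique n))
    where
    vertex : HasClique (F 1) 1
    vertex = (λ _ → nonempty₁) , λ { fzero fzero i≢j → ⊥-elim (i≢j refl) }

  -- The whole vertex set is a flat because looplessness makes its perp empty.
  F-CliqueNumber-shared : ∀ n → ∃ λ N → CliqueNumber (F n) N × CliqueNumber (F N) N
  F-CliqueNumber-shared n =
    let (N , rank , equiv) = linear n full full-isFlat
        ω[full]≡N : CliqueNumber (Induced (F n) full) N
        ω[full]≡N = HomEquiv-CliqueNumber (Induced (F n) (perp² (F n) full)) (Induced (F n) full)
          (Induced-flat (F n) full-isFlat) rank
    in N , HomEquiv-CliqueNumber (Induced (F n) full) (F n) (Induced-full (F n)) ω[full]≡N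
         , HomEquiv-CliqueNumber (Induced (F n) full) (F N) equiv ω[full]≡N
    where
    full : Subset (F n)
    full _ = ⊤
    full-isFlat : IsFlat (F n) full
    full-isFlat x = (λ _ → tt) , λ _ y y⊥ → ⊥-elim (loopless n y (y⊥ y tt))

  -- If N > n, the join F n + F (N ∸ n) → F N would carry a clique of size N + (N ∸ n) > N.
  F-CliqueNumber : ∀ n → CliqueNumber (F n) n
  F-CliqueNumber n =
    let (N , ω[Fn]≡N , ω[FN]≡N) = F-CliqueNumber-shared n
        n≤N : n ≤ N
        n≤N = HasClique⇒≤ (F n) (F-HasClique n) (proj₂ ω[Fn]≡N)
        big-clique : HasClique (F N) (N + (N ∸ n))
        big-clique = subst (λ t → HasClique (F t) (N + (N ∸ n))) (m+[n∸m]≡n n≤N)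
          (Hom-HasClique (Join (F n) (F (N ∸ n))) (F (n + (N ∸ n))) (joinHom n (N ∸ n))
            (Join-HasClique (F n) (F (N ∸ n)) (proj₁ ω[Fn]≡N) (F-HasClique (N ∸ n))))
        N+[N∸n]≤N+0 : N + (N ∸ n) ≤ N + 0
        N+[N∸n]≤N+0 = subst (N + (N ∸ n) ≤_) (≡-sym (+-identityʳ N))
          (HasClique⇒≤ (F N) big-clique (proj₂ ω[FN]≡N))
        N≤n : N ≤ n
        N≤n = m∸n≡0⇒m≤n (n≤0⇒n≡0 (+-cancelˡ-≤ N (N ∸ n) 0 N+[N∸n]≤N+0))
    in subst (CliqueNumber (F n)) (≤-antisym N≤n n≤N) ω[Fn]≡N

  closureRank : ∀ m (U : Subset (F m)) →
    ∃ λ k → Rank (F m) U k × HomEquiv (Induced (F m) (perp² (F m) U)) (F k)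
  closureRank m U =
    let (k , rank , equiv) = linear m (perp² (F m) U) (perp²-isFlat (F m) U)
    in k , Rank-perp² (F m) rank , equiv

  module _ (G : Graph 0ℓ) where

    representation⇒Hom-/ᵍ : ∀ {m r k} (φ : Hom G (PowerGraph (F m))) → IsRankRep F G r m φ →
      Hom (Induced (F m) (perp² (F m) (Union {X = F m} G (proj₁ φ)))) (F k) → Hom G (F k /ᵍ r)
    representation⇒Hom-/ᵍ {m} {r} {k} (φ , φ-adj) rep toFk = Hom-/ᵍ (F k) (loopless k) G cliques joined
      where
      W : Subset (F m)
      W = perp² (F m) (Union {X = F m} G φ)

      cliques : V G → HasClique (F k) r
      cliques v = Hom-HasClique (Induced (F m) W) (F k) toFk
        (Hom-HasClique (Induced (F m) (perp² (F m) (φ v))) (Induced (F m) W)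
          (Induced-⊆ (F m) (perp²-monotone (F m) (λ x φvx → v , φvx))) (rep v))

      joined : ∀ {v w} → adj G v w → ∀ i j → adj (F k) (proj₁ (cliques v) i) (proj₁ (cliques w) j)
      joined {v} {w} e i j = proj₂ toFk (lift (perp²-joined (F m) (proj₂ (φ-adj e)) _ _
        (proj₂ (proj₁ (rep v) i)) (proj₂ (proj₁ (rep w) j))))

    RepSet⊆EtaSet : ∀ p → RepSet F G p → EtaSet F G p
    RepSet⊆EtaSet p (r′ , m , φ , rep , k , rank , p≡k/r) with closureRank m (Union {X = F m} G (proj₁ φ))
    ... | k′ , rank′ , (toFk′ , _) =
      k , r′ , subst (λ t → Hom G (F t /ᵍ suc r′)) k′≡k (representation⇒Hom-/ᵍ φ rep toFk′) , p≡k/r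
      where
      k′≡k : k′ ≡ k
      k′≡k = CliqueNumber-unique (Induced (F m) (perp² (F m) (Union {X = F m} G (proj₁ φ))))
        rank′ rank

    EtaSet-coinitial : ∀ p → EtaSet F G p → ∃ λ p′ → RepSet F G p′ × p′ ≤ℚ p
    EtaSet-coinitial p (n , d′ , h , p≡n/d) =
      let φ : Hom G (PowerGraph (F n))
          φ = /ᵍ⇒PowerGraph (F n) G h
          (k , rank , _) = closureRank n (Union {X = F n} G (proj₁ φ))
          k≤n : k ≤ n
          k≤n = HasClique⇒≤ (F n) (Rank⇒HasClique (F n) rank) (proj₂ (F-CliqueNumber n))
      in (+ k) / suc d′ ,
         (d′ , n , φ , (λ v → IsCliqueSet⇒RankAtLeast (F n) (proj₂ (proj₁ h v))) , k , rank , refl) ,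
         subst ((+ k) / suc d′ ≤ℚ_) (≡-sym p≡n/d) (/-monoˡ-≤ d′ k≤n)

proposition4p12 : ∀ {ℓ} (F : ℕ → Graph ℓ) → IsSemiringFamily F → (∀ n → Loopless (F n)) →
    IsLinearLike F → (G : Graph 0ℓ) → Loopless G → Finite G →
    SameInf (EtaSet F G) (RepSet F G)
proposition4p12 F semiring loopless linear G _ _ =
  SameInf-coinitial (RepSet⊆EtaSet G) (EtaSet-coinitial G)
  where open LinearLike F semiring loopless linear
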